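{- Let $G$ be a graph and $a,b$ positive integers. If $G$ has a $b$-fold $L$-coloring for every flat $a$-assignment $L$ for $G$, then $G$ is $(a,b)$-choosable.
   Context: An $a$-assignment $L$ assigns to each vertex $v$ a set $L(v)$ of exactly $a$ colors; $\mathrm{pot}(L)=\bigcup_v L(v)$. A $b$-fold $L$-coloring is a function $\varphi$ with $\varphi(v)\subseteq L(v)$, $|\varphi(v)|=b$, and $\varphi(x)\cap\varphi(y)=\emptyset$ for every edge $xy$; $G$ is $(a,b)$-choosable if it has a $b$-fold $L$-coloring for every $a$-assignment $L$. For $\alpha\in\mathrm{pot}(L)$, $G_\alpha$ is the subgraph induced by the vertices whose lists contain $\alpha$. A flattening move: choose $\alpha\in\mathrm{pot}(L)$, a component $C$ of $G_\alpha$, and $\beta\in\mathrm{pot}(L)\setminus\bigcup_{v\in V(C)}L(v)$, and replace $\alpha$ by $\beta$ in $L(v)$ for all $v\in V(C)$. Writing $\#(H)$ for the number of components of $H$, a list assignment $L$ is flat if, among all list assignments $L'$ obtainable from $L$ by a sequence of flattening moves (including $L$ itself), $L$ minimizes $|\mathrm{pot}(L')|$ and, subject to that, minimizes $\sum_{\alpha\in\mathrm{pot}(L')}\#(G_\alpha)$. -}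

module Defs where

open import Data.Bool using (Bool; true; false; _∧_; _∨_; not; if_then_else_; T)
open import Data.Nat using (ℕ; zero; suc; _≤_; _<ᵇ_; _≡ᵇ_) renaming (_≟_ to _≟ℕ_)
open import Data.Fin using (Fin; toℕ)
open import Data.Fin.Properties using () renaming (_≟_ to _≟ᶠ_)
open import Data.List using (List; []; _∷_; length; map; concatMap; deduplicate; filterᵇ; allFin)
open import Data.Bool.ListAction using (any; all)
open import Data.Nat.ListAction using (sum)
open import Data.List.Relation.Unary.Unique.Propositional using (Unique)
open import Data.List.Relation.Binary.Subset.Propositional using (_⊆_)
open import Data.List.Relation.Binary.Disjoint.Propositional using (Disjoint)
open import Data.List.Membership.Propositional using (_∈_; _∉_)
open import Data.Product using (Σ; _×_; _,_; ∃)
open import Relation.Binary.PropositionalEquality using (_≡_)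
open import Relation.Binary.Construct.Closure.ReflexiveTransitive using (Star)
open import Relation.Nullary.Decidable using (⌊_⌋)

record Graph (n : ℕ) : Set where
  field
    adj     : Fin n → Fin n → Bool
    symm    : ∀ x y → adj x y ≡ adj y x
    irrefl  : ∀ x → adj x x ≡ false
open Graph public

Assignment : ℕ → Set
Assignment n = Fin n → List ℕ

IsAssignment : ∀ {n} → ℕ → Assignment n → Set
IsAssignment a L = ∀ v → Unique (L v) × length (L v) ≡ a

IsFoldColoring : ∀ {n} → Graph n → ℕ → Assignment n → (Fin n → List ℕ) → Set
IsFoldColoring G b L φ =
  (∀ v → Unique (φ v) × length (φ v) ≡ b × φ v ⊆ L v) ×
  (∀ x y → adj G x y ≡ true → Disjoint (φ x) (φ y))

HasFoldColoring : ∀ {n} → Graph n → ℕ → Assignment n → Set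
HasFoldColoring {n} G b L = Σ (Fin n → List ℕ) (IsFoldColoring G b L)

Choosable : ∀ {n} → Graph n → ℕ → ℕ → Set
Choosable {n} G a b = (L : Assignment n) → IsAssignment a L → HasFoldColoring G b L

_∈ᵇ_ : ℕ → List ℕ → Bool
α ∈ᵇ xs = any (λ c → c ≡ᵇ α) xs

pot : ∀ {n} → Assignment n → List ℕ
pot {n} L = deduplicate _≟ℕ_ (concatMap L (allFin n))

potSize : ∀ {n} → Assignment n → ℕ
potSize L = length (pot L)

-- reach G L α k x y: x and y are joined by a walk of length ≤ k in G_α
-- (the subgraph induced by vertices whose list contains α).
reach : ∀ {n} → Graph n → Assignment n → ℕ → ℕ → Fin n → Fin n → Bool
reach G L α zero    x y = (α ∈ᵇ L x) ∧ ⌊ x ≟ᶠ y ⌋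
reach {n} G L α (suc k) x y =
  reach G L α k x y ∨ any (λ z → reach G L α k x z ∧ adj G z y ∧ (α ∈ᵇ L y)) (allFin n)

-- x and y lie in the same component of G_α (walks of length ≤ n suffice on n vertices).
connected : ∀ {n} → Graph n → Assignment n → ℕ → Fin n → Fin n → Bool
connected {n} G L α = reach G L α n

-- #(G_α): number of components of G_α, counted as the number of vertices of G_α
-- that are the least vertex (w.r.t. the order of Fin n) of their component.
numComponents : ∀ {n} → Graph n → Assignment n → ℕ → ℕ
numComponents {n} G L α =
  length (filterᵇ (λ v → (α ∈ᵇ L v) ∧
                        all (λ u → not ((toℕ u <ᵇ toℕ v) ∧ connected G L α u v)) (allFin n))
                  (allFin n))

componentSum : ∀ {n} → Graph n → Assignment n → ℕ
componentSum G L = sum (map (numComponents G L) (pot L))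

replace : ℕ → ℕ → List ℕ → List ℕ
replace α β = map (λ c → if c ≡ᵇ α then β else c)

-- One flattening move from L to L': pick α ∈ pot(L), the component C of G_α containing
-- a vertex r (with α ∈ L(r)), and β ∈ pot(L) not in any list of C; replace α by β on C.
data FlatMove {n} (G : Graph n) (L : Assignment n) : Assignment n → Set where
  move : (α : ℕ) (r : Fin n) (β : ℕ) →
         α ∈ pot L → α ∈ L r → β ∈ pot L →
         (∀ v → connected G L α r v ≡ true → β ∉ L v) →
         FlatMove G L (λ v → if connected G L α r v then replace α β (L v) else L v)

Obtainable : ∀ {n} → Graph n → Assignment n → Assignment n → Set
Obtainable G = Star (λ L L' → FlatMove G L L')

Flat : ∀ {n} → Graph n → Assignment n → Set
Flat G L =
  (∀ L' → Obtainable G L L' → potSize L ≤ potSize L') ×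
  (∀ L' → Obtainable G L L' → potSize L' ≡ potSize L → componentSum G L ≤ componentSum G L')

-- A flattening move changes the lists on one component C of G_α by the transposition (α β),
-- β occurring in no list of C; applying the same transposition on C to a b-fold colouring of
-- the new assignment gives one of the old, because a colour shared across an edge leaving C
-- could only be α, which would put the far endpoint into C.  A move also keeps an a-assignment
-- an a-assignment.  Hence, by well-founded induction on (|pot L|, Σ_α #(G_α)) ordered
-- lexicographically, an uncolourable a-assignment would admit no obtainable assignment of
-- smaller measure, i.e. it would be flat and so colourable.  This only shows that colourings
-- cannot fail to exist; they do exist since having a b-fold L-colouring is decidable, there
-- being finitely many candidate colourings up to reordering the lists.
module Submission where

open import Defs
open import Data.Bool using (Bool; true; false; _∧_; _∨_; if_then_else_)
import Data.Bool.Properties as Boolₚ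
open import Data.Bool.ListAction using (any)
open import Data.Fin using (Fin)
import Data.Fin as Fin
import Data.Fin.Properties as Finₚ
open import Data.Fin.Subset using (Subset; Nonempty; ∣_∣) renaming (_∈_ to _∈ˢ_; _⊆_ to _⊆ˢ_)
open import Data.Fin.Subset.Properties using (p⊂q⇒∣p∣<∣q∣; ∣p∣≤n; ⊥⊆; ∉⊥; ∣⊥∣≡0) renaming (_∈?_ to _∈ˢ?_)
open import Data.List using (List; []; _∷_; [_]; length; map; filter; _++_; cartesianProductWith; allFin)
open import Data.List.Properties using (filter-notAll; length-map; map-cong-local)
open import Data.List.Membership.Propositional using (_∈_; _∉_; lose)
open import Data.List.Membership.Propositional.Properties
  using (∈-map⁺; ∈-map⁻; ∈-filter⁺; ∈-filter⁻; ∈-++⁺ˡ; ∈-++⁺ʳ; ∈-cartesianProductWith⁺; ∈-allFin)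
open import Data.List.Relation.Unary.Any as Any using (Any; here; there; any?; satisfied)
open import Data.List.Relation.Unary.Any.Properties using (any⁺; any⁻)
import Data.List.Relation.Unary.All as All
open import Data.List.Relation.Unary.Unique.Propositional using (Unique; _∷_)
import Data.List.Relation.Unary.Unique.Propositional.Properties as Uniqueₚ
open import Data.List.Relation.Binary.Subset.Propositional using (_⊆_)
open import Data.List.Relation.Binary.Disjoint.Propositional using (Disjoint)
import Data.List.Relation.Binary.Disjoint.Propositional.Properties as Disjointₚ
open import Data.Nat using (ℕ; zero; suc; _≤_; _<_; _≡ᵇ_; _≟_; z≤n; s≤s)
open import Data.Nat.Induction using (<-wellFounded)
open import Data.Nat.Properties using (≤-trans; ≤-antisym; <-irrefl; ≮⇒≥; ≡ᵇ⇒≡; ≡⇒≡ᵇ)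
open import Data.List.Membership.DecPropositional _≟_ using (_∈?_)
open import Data.List.Relation.Unary.Unique.DecPropositional _≟_ using (unique?)
open import Data.List.Relation.Binary.Disjoint.DecPropositional _≟_ using (disjoint?)
open import Data.List.Relation.Binary.Subset.DecPropositional _≟_ using (_⊆?_)
open import Data.Product using (∃; _×_; _,_; proj₁; proj₂)
open import Data.Product.Relation.Binary.Lex.Strict using (×-Lex; ×-wellFounded)
open import Data.Sum using (_⊎_; inj₁; inj₂)
open import Data.Vec using (tabulate)
open import Data.Vec.Properties using (lookup∘tabulate; lookup⇒[]=; []=⇒lookup)
open import Data.Vec.Functional as Vector using (Vector)
open import Function using (id; _∘_; _on_; Equivalence)
open import Induction.WellFounded as WF using (WellFounded)
import Relation.Binary.Construct.On as On
open import Relation.Binary.Construct.Closure.ReflexiveTransitive using (ε; _◅_)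
open import Relation.Binary.Definitions using (DecidableEquality)
open import Relation.Binary.PropositionalEquality using (_≡_; _≢_; refl; sym; trans; cong; subst; subst₂; _≗_)
open import Relation.Nullary using (¬_; ¬?; Dec; yes; no; contradiction)
open import Relation.Nullary.Decidable
  using (_×-dec_; _→-dec_; map′; decidable-stable; toWitness; fromWitness; dec-true; dec-false)
open import Relation.Unary using (Pred; Decidable)

∨-true⁻ : ∀ {x y} → x ∨ y ≡ true → x ≡ true ⊎ y ≡ true
∨-true⁻ {true}  _ = inj₁ refl
∨-true⁻ {false} e = inj₂ e

∨-trueˡ : ∀ {x} y → x ≡ true → x ∨ y ≡ true
∨-trueˡ y refl = refl

∨-trueʳ : ∀ x {y} → y ≡ true → x ∨ y ≡ true
∨-trueʳ true  _ = refl
∨-trueʳ false e = e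

∧-true⁺ : ∀ {x y} → x ≡ true → y ≡ true → x ∧ y ≡ true
∧-true⁺ refl refl = refl

∧-true⁻ : ∀ {x y} → x ∧ y ≡ true → x ≡ true × y ≡ true
∧-true⁻ e = Boolₚ.∧-conicalˡ _ _ e , Boolₚ.∧-conicalʳ _ _ e

module _ {A : Set} (p : A → Bool) where

  any-true⁻ : ∀ xs → any p xs ≡ true → Any (λ z → p z ≡ true) xs
  any-true⁻ xs = Any.map (Equivalence.to Boolₚ.T-≡) ∘ any⁻ p xs ∘ Equivalence.from Boolₚ.T-≡

  any-true⁺ : ∀ {xs} → Any (λ z → p z ≡ true) xs → any p xs ≡ true
  any-true⁺ = Equivalence.to Boolₚ.T-≡ ∘ any⁺ p ∘ Any.map (Equivalence.from Boolₚ.T-≡)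

∈ᵇ⇒∈ : ∀ {α xs} → α ∈ᵇ xs ≡ true → α ∈ xs
∈ᵇ⇒∈ {α} {xs} = Any.map (λ e → sym (≡ᵇ⇒≡ _ α (Equivalence.from Boolₚ.T-≡ e))) ∘ any-true⁻ (_≡ᵇ α) xs

∈⇒∈ᵇ : ∀ {α xs} → α ∈ xs → α ∈ᵇ xs ≡ true
∈⇒∈ᵇ {α} = any-true⁺ (_≡ᵇ α) ∘ Any.map (λ { refl → Equivalence.to Boolₚ.T-≡ (≡⇒≡ᵇ α α refl) })

∈-tabulate⁺ : ∀ {m} {f : Fin m → Bool} {x} → f x ≡ true → x ∈ˢ tabulate f
∈-tabulate⁺ {f = f} {x} e = lookup⇒[]= x (tabulate f) (trans (lookup∘tabulate f x) e)

∈-tabulate⁻ : ∀ {m} {f : Fin m → Bool} {x} → x ∈ˢ tabulate f → f x ≡ true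
∈-tabulate⁻ {f = f} {x} x∈ = trans (sym (lookup∘tabulate f x)) ([]=⇒lookup x∈)

-- Decidability of colourability

module _ {A : Set} (_≟ᴬ_ : DecidableEquality A) where

  Unique-⊆⇒length≤ : ∀ {xs ys : List A} → Unique xs → xs ⊆ ys → length xs ≤ length ys
  Unique-⊆⇒length≤ {[]}     _          _       = z≤n
  Unique-⊆⇒length≤ {x ∷ xs} {ys} (x∉xs ∷ u) x∷xs⊆ys =
    ≤-trans (s≤s (Unique-⊆⇒length≤ u xs⊆ys-x)) (filter-notAll ≢x? ys (lose (x∷xs⊆ys (here refl)) λ x≢x → x≢x refl))
    where
    ≢x? : Decidable (_≢ x)
    ≢x? y = ¬? (y ≟ᴬ x)
    xs⊆ys-x : xs ⊆ filter ≢x? ys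
    xs⊆ys-x y∈xs = ∈-filter⁺ ≢x? (x∷xs⊆ys (there y∈xs)) (λ y≡x → All.lookup x∉xs y∈xs (sym y≡x))

  sublists : List A → List (List A)
  sublists []       = [ [] ]
  sublists (x ∷ xs) = sublists xs ++ map (x ∷_) (sublists xs)

  filter∈sublists : ∀ {p} {P : Pred A p} (P? : Decidable P) xs → filter P? xs ∈ sublists xs
  filter∈sublists P? []       = here refl
  filter∈sublists P? (x ∷ xs) with P? x
  ... | yes _ = ∈-++⁺ʳ (sublists xs) (∈-map⁺ (x ∷_) (filter∈sublists P? xs))
  ... | no  _ = ∈-++⁺ˡ (filter∈sublists P? xs)

choices : ∀ {A : Set} n → Vector (List A) n → List (Vector A n)
choices zero    _     = [ Vector.[] ]
choices (suc n) cands = cartesianProductWith Vector._∷_ (Vector.head cands) (choices n (Vector.tail cands))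

∈-choices : ∀ {A : Set} n (cands : Vector (List A) n) (f : Vector A n) → (∀ i → f i ∈ cands i) →
            ∃ λ g → g ∈ choices n cands × g ≗ f
∈-choices zero    cands f f∈ = Vector.[] , here refl , λ ()
∈-choices (suc n) cands f f∈
  with g , g∈ , g≗f ← ∈-choices n (Vector.tail cands) (Vector.tail f) (f∈ ∘ Fin.suc) =
  Vector.head f Vector.∷ g , ∈-cartesianProductWith⁺ Vector._∷_ (f∈ Fin.zero) g∈ ,
  λ { Fin.zero → refl ; (Fin.suc i) → g≗f i }

module _ {n} (G : Graph n) (b : ℕ) (L : Assignment n) where

  isFoldColoring? : ∀ φ → Dec (IsFoldColoring G b L φ)
  isFoldColoring? φ =
    Finₚ.all? (λ v → unique? (φ v) ×-dec (length (φ v) ≟ b) ×-dec (φ v ⊆? L v)) ×-dec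
    Finₚ.all? (λ x → Finₚ.all? (λ y → (adj G x y Boolₚ.≟ true) →-dec disjoint? (φ x) (φ y)))

  IsFoldColoring-resp-≗ : ∀ {φ ψ} → φ ≗ ψ → IsFoldColoring G b L φ → IsFoldColoring G b L ψ
  IsFoldColoring-resp-≗ φ≗ψ (vertex , edge) =
    (λ v → subst (λ c → Unique c × length c ≡ b × c ⊆ L v) (φ≗ψ v) (vertex v)) ,
    (λ x y xy → subst₂ Disjoint (φ≗ψ x) (φ≗ψ y) (edge x y xy))

  restrict : (Fin n → List ℕ) → Fin n → List ℕ
  restrict φ v = filter (_∈? φ v) (L v)

  restrict-coloring : (∀ v → Unique (L v)) → ∀ {φ} → IsFoldColoring G b L φ → IsFoldColoring G b L (restrict φ)
  restrict-coloring uniqueL {φ} (vertex , edge) =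
    (λ v → vertex-restrict v (vertex v)) , (λ x y xy (p , q) → edge x y xy (⊆φ x p , ⊆φ y q))
    where
    ⊆φ : ∀ v → restrict φ v ⊆ φ v
    ⊆φ v = proj₂ ∘ ∈-filter⁻ (_∈? φ v) {xs = L v}
    vertex-restrict : ∀ v → Unique (φ v) × length (φ v) ≡ b × φ v ⊆ L v →
                      Unique (restrict φ v) × length (restrict φ v) ≡ b × restrict φ v ⊆ L v
    vertex-restrict v (uφ , lφ , φ⊆L) =
      u , subst (length (restrict φ v) ≡_) lφ (≤-antisym ≤φ φ≤) , proj₁ ∘ ∈-filter⁻ (_∈? φ v) {xs = L v}
      where
      u  = Uniqueₚ.filter⁺ (_∈? φ v) (uniqueL v)
      ≤φ = Unique-⊆⇒length≤ _≟_ u (⊆φ v)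
      φ≤ = Unique-⊆⇒length≤ _≟_ uφ (λ c∈φ → ∈-filter⁺ (_∈? φ v) (φ⊆L c∈φ) c∈φ)

  -- Restricting makes every colouring pointwise equal to one with values among the sublists of the L v.
  hasFoldColoring? : (∀ v → Unique (L v)) → Dec (HasFoldColoring G b L)
  hasFoldColoring? uniqueL = map′ satisfied complete (any? isFoldColoring? candidates)
    where
    candidates = choices n (λ v → sublists _≟_ (L v))
    complete : HasFoldColoring G b L → Any (IsFoldColoring G b L) candidates
    complete (φ , col)
      with g , g∈ , g≗ ← ∈-choices n _ (restrict φ) (λ v → filter∈sublists _≟_ (_∈? φ v) (L v)) =
      lose g∈ (IsFoldColoring-resp-≗ (sym ∘ g≗) (restrict-coloring uniqueL col))

-- Components of G_α

module _ {m} (S : ℕ → Subset m) (S-increasing : ∀ k → S k ⊆ˢ S (suc k))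
         (S-stable : ∀ k → S (suc k) ⊆ˢ S k → S (suc (suc k)) ⊆ˢ S (suc k)) where

  private
    stabilised-or-large : Nonempty (S 0) → ∀ k → S (suc k) ⊆ˢ S k ⊎ suc k ≤ ∣ S (suc k) ∣
    stabilised-or-large (x , x∈S₀) zero =
      inj₂ (subst (_< ∣ S 1 ∣) (∣⊥∣≡0 m) (p⊂q⇒∣p∣<∣q∣ (⊥⊆ , x , S-increasing 0 x∈S₀ , ∉⊥)))
    stabilised-or-large ne (suc k) with stabilised-or-large ne k
    ... | inj₁ stable = inj₁ (S-stable k stable)
    ... | inj₂ large with Finₚ.any? (λ y → y ∈ˢ? S (suc (suc k)) ×-dec ¬? (y ∈ˢ? S (suc k)))
    ... | yes (y , y∈ , y∉) = inj₂ (≤-trans (s≤s large) (p⊂q⇒∣p∣<∣q∣ (S-increasing (suc k) , y , y∈ , y∉)))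
    ... | no  ∄new          = inj₁ λ {y} y∈ → decidable-stable (y ∈ˢ? S (suc k)) (λ y∉ → ∄new (y , y∈ , y∉))

  increasing-chain-stabilises : Nonempty (S 0) → S (suc m) ⊆ˢ S m
  increasing-chain-stabilises ne with stabilised-or-large ne m
  ... | inj₁ stable = stable
  ... | inj₂ large  = contradiction (≤-trans large (∣p∣≤n (S (suc m)))) (<-irrefl refl)

module Components {n} (G : Graph n) (L : Assignment n) (α : ℕ) where

  Reach : ℕ → Fin n → Fin n → Set
  Reach k x y = reach G L α k x y ≡ true

  Step : ℕ → Fin n → Fin n → Set
  Step k x y = ∃ λ z → Reach k x z × adj G z y ≡ true × α ∈ᵇ L y ≡ true

  reach-suc⁻ : ∀ k {x y} → Reach (suc k) x y → Reach k x y ⊎ Step k x y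
  reach-suc⁻ k {x} {y} r with ∨-true⁻ {reach G L α k x y} r
  ... | inj₁ r′ = inj₁ r′
  ... | inj₂ s  with z , w ← satisfied (any-true⁻ _ (allFin n) s) =
    let r′ , w′ = ∧-true⁻ w in inj₂ (z , r′ , ∧-true⁻ w′)

  reach-suc⁺ : ∀ k {x y} → Reach k x y ⊎ Step k x y → Reach (suc k) x y
  reach-suc⁺ k (inj₁ r) = ∨-trueˡ _ r
  reach-suc⁺ k {x} {y} (inj₂ (z , r , zy , α∈Ly)) =
    ∨-trueʳ (reach G L α k x y) (any-true⁺ _ (Any.map (λ { refl → ∧-true⁺ r (∧-true⁺ zy α∈Ly) }) (∈-allFin z)))

  reach-α : ∀ k {x y} → Reach k x y → α ∈ L x × α ∈ L y
  reach-α zero {x} r with α∈Lx , x≟y ← ∧-true⁻ {α ∈ᵇ L x} r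
    with refl ← toWitness (Equivalence.from Boolₚ.T-≡ x≟y) = ∈ᵇ⇒∈ α∈Lx , ∈ᵇ⇒∈ α∈Lx
  reach-α (suc k) r with reach-suc⁻ k r
  ... | inj₁ r′                  = reach-α k r′
  ... | inj₂ (_ , r′ , _ , α∈Ly) = proj₁ (reach-α k r′) , ∈ᵇ⇒∈ α∈Ly

  reach-refl : ∀ k {x} → α ∈ L x → Reach k x x
  reach-refl zero    {x} α∈Lx = ∧-true⁺ (∈⇒∈ᵇ α∈Lx) (Equivalence.to Boolₚ.T-≡ (fromWitness {a? = x Finₚ.≟ x} refl))
  reach-refl (suc k) α∈Lx     = reach-suc⁺ k (inj₁ (reach-refl k α∈Lx))

  reachable : ℕ → Fin n → Subset n
  reachable k x = tabulate (reach G L α k x)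

  reachable-increasing : ∀ x k → reachable k x ⊆ˢ reachable (suc k) x
  reachable-increasing x k = ∈-tabulate⁺ ∘ reach-suc⁺ k ∘ inj₁ ∘ ∈-tabulate⁻

  reachable-stable : ∀ x k → reachable (suc k) x ⊆ˢ reachable k x →
                     reachable (suc (suc k)) x ⊆ˢ reachable (suc k) x
  reachable-stable x k stable y∈ with reach-suc⁻ (suc k) (∈-tabulate⁻ y∈)
  ... | inj₁ r = ∈-tabulate⁺ r
  ... | inj₂ (z , r , zy , α∈Ly) =
    ∈-tabulate⁺ (reach-suc⁺ k (inj₂ (z , ∈-tabulate⁻ (stable (∈-tabulate⁺ r)) , zy , α∈Ly)))

  -- connected only looks at walks of length at most n, so this needs the pigeonhole argument above.
  connected-closed : ∀ {x y z} → connected G L α x y ≡ true → adj G y z ≡ true → α ∈ L z →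
                     connected G L α x z ≡ true
  connected-closed {x} {y} r yz α∈Lz =
    ∈-tabulate⁻ (increasing-chain-stabilises (λ k → reachable k x) (reachable-increasing x) (reachable-stable x)
                   (x , ∈-tabulate⁺ (reach-refl 0 (proj₁ (reach-α n r))))
                   (∈-tabulate⁺ (reach-suc⁺ n (inj₂ (y , r , yz , ∈⇒∈ᵇ α∈Lz)))))

-- Flattening moves

transpose : ℕ → ℕ → ℕ → ℕ
transpose α β c = if c ≡ᵇ α then β else if c ≡ᵇ β then α else c

module _ (α β : ℕ) where

  transpose-α : transpose α β α ≡ β
  transpose-α rewrite dec-true (α ≟ α) refl = refl

  transpose-β : transpose α β β ≡ α
  transpose-β with β ≟ α
  ... | yes refl = transpose-α
  ... | no  β≢α rewrite dec-false (β ≟ α) β≢α | dec-true (β ≟ β) refl = refl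

  transpose-fixes : ∀ {c} → c ≢ α → c ≢ β → transpose α β c ≡ c
  transpose-fixes {c} c≢α c≢β rewrite dec-false (c ≟ α) c≢α | dec-false (c ≟ β) c≢β = refl

  transpose-involutive : ∀ c → transpose α β (transpose α β c) ≡ c
  transpose-involutive c with c ≟ α | c ≟ β
  ... | yes refl | _        = trans (cong (transpose α β) transpose-α) transpose-β
  ... | no  _    | yes refl = trans (cong (transpose α β) transpose-β) transpose-α
  ... | no  c≢α  | no  c≢β  = trans (cong (transpose α β) (transpose-fixes c≢α c≢β)) (transpose-fixes c≢α c≢β)

  transpose-injective : ∀ {c d} → transpose α β c ≡ transpose α β d → c ≡ d
  transpose-injective {c} {d} e =
    trans (sym (transpose-involutive c)) (trans (cong (transpose α β) e) (transpose-involutive d))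

  ∈-map-transpose⁻ : ∀ {c xs} → c ∈ map (transpose α β) xs → transpose α β c ∈ xs
  ∈-map-transpose⁻ c∈ with d , d∈ , refl ← ∈-map⁻ (transpose α β) c∈ =
    subst (_∈ _) (sym (transpose-involutive d)) d∈

  replace≡map-transpose : ∀ {xs} → β ∉ xs → replace α β xs ≡ map (transpose α β) xs
  replace≡map-transpose β∉xs = map-cong-local (All.tabulate λ {c} c∈ → agree c λ { refl → β∉xs c∈ })
    where
    agree : ∀ c → c ≢ β → (if c ≡ᵇ α then β else c) ≡ transpose α β c
    agree c c≢β with c ≟ α
    ... | yes refl rewrite dec-true (c ≟ c) refl = refl
    ... | no  c≢α  rewrite dec-false (c ≟ α) c≢α | dec-false (c ≟ β) c≢β = refl

module FlatteningMove {n} (G : Graph n) (L : Assignment n) (α : ℕ) (r : Fin n) (β : ℕ)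
  (β∉C : ∀ v → connected G L α r v ≡ true → β ∉ L v) where

  C : Fin n → Bool
  C = connected G L α r

  L′ : Assignment n
  L′ v = if C v then replace α β (L v) else L v

  relabel : Bool → List ℕ → List ℕ
  relabel true  = map (transpose α β)
  relabel false = id

  L′≡relabel : ∀ v → L′ v ≡ relabel (C v) (L v)
  L′≡relabel v with C v in e
  ... | true  = replace≡map-transpose α β (β∉C v e)
  ... | false = refl

  relabel-involutive-⊆ : ∀ b {xs ys} → xs ⊆ relabel b ys → relabel b xs ⊆ ys
  relabel-involutive-⊆ true  xs⊆ys c∈ =
    subst (_∈ _) (transpose-involutive α β _) (∈-map-transpose⁻ α β (xs⊆ys (∈-map-transpose⁻ α β c∈)))
  relabel-involutive-⊆ false xs⊆ys = xs⊆ys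

  relabel-unique : ∀ b {xs} → Unique xs → Unique (relabel b xs)
  relabel-unique true  = Uniqueₚ.map⁺ (transpose-injective α β)
  relabel-unique false = id

  length-relabel : ∀ b xs → length (relabel b xs) ≡ length xs
  length-relabel true  = length-map (transpose α β)
  length-relabel false _ = refl

  relabel-disjoint : ∀ b {xs ys} → Disjoint xs ys → Disjoint (relabel b xs) (relabel b ys)
  relabel-disjoint true  xs∩ys (p , q) = xs∩ys (∈-map-transpose⁻ α β p , ∈-map-transpose⁻ α β q)
  relabel-disjoint false xs∩ys = xs∩ys

  open Components G L α using (connected-closed)

  -- A shared colour c lies in L x ∩ L y; c = α would put y into C, c = β is excluded on C,
  -- and any other colour is fixed by the transposition.
  boundary-disjoint : ∀ {x y} → adj G x y ≡ true → C x ≡ true → C y ≡ false → ∀ {xs ys} →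
                      xs ⊆ map (transpose α β) (L x) → ys ⊆ L y → Disjoint xs ys →
                      Disjoint (map (transpose α β) xs) ys
  boundary-disjoint {x} xy Cx Cy xs⊆ ys⊆ xs∩ys {c} (p , q)
    with c∈Lx ← relabel-involutive-⊆ true xs⊆ p | c ≟ α | c ≟ β
  ... | yes refl | _        = contradiction (trans (sym (connected-closed Cx xy (ys⊆ q))) Cy) λ ()
  ... | no _     | yes refl = β∉C x Cx c∈Lx
  ... | no c≢α   | no c≢β   = xs∩ys (subst (_∈ _) (transpose-fixes α β c≢α c≢β) (∈-map-transpose⁻ α β p) , q)

  edge-disjoint : ∀ {x y} → adj G x y ≡ true → ∀ {bx by} → C x ≡ bx → C y ≡ by → ∀ {xs ys} →
                  xs ⊆ relabel bx (L x) → ys ⊆ relabel by (L y) → Disjoint xs ys →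
                  Disjoint (relabel bx xs) (relabel by ys)
  edge-disjoint xy {true}  {true}  _  _  _   _   = relabel-disjoint true
  edge-disjoint xy {false} {false} _  _  _   _   = relabel-disjoint false
  edge-disjoint xy {true}  {false} Cx Cy xs⊆ ys⊆ = boundary-disjoint xy Cx Cy xs⊆ ys⊆
  edge-disjoint {x} {y} xy {false} {true} Cx Cy xs⊆ ys⊆ =
    Disjointₚ.sym ∘ boundary-disjoint (trans (symm G y x) xy) Cy Cx ys⊆ xs⊆ ∘ Disjointₚ.sym

  assignment : ∀ {a} → IsAssignment a L → IsAssignment a L′
  assignment isA v rewrite L′≡relabel v =
    relabel-unique (C v) (proj₁ (isA v)) , trans (length-relabel (C v) (L v)) (proj₂ (isA v))

  pullback : ∀ {b} → HasFoldColoring G b L′ → HasFoldColoring G b L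
  pullback {b} (φ′ , vertex , edge) = φ , vertex-ok , edge-ok
    where
    φ : Fin n → List ℕ
    φ v = relabel (C v) (φ′ v)
    φ′⊆ : ∀ v → φ′ v ⊆ relabel (C v) (L v)
    φ′⊆ v = subst (φ′ v ⊆_) (L′≡relabel v) (proj₂ (proj₂ (vertex v)))
    vertex-ok : ∀ v → Unique (φ v) × length (φ v) ≡ b × φ v ⊆ L v
    vertex-ok v = let u , l , _ = vertex v in
      relabel-unique (C v) u , trans (length-relabel (C v) (φ′ v)) l , relabel-involutive-⊆ (C v) (φ′⊆ v)
    edge-ok : ∀ x y → adj G x y ≡ true → Disjoint (φ x) (φ y)
    edge-ok x y xy = edge-disjoint xy refl refl (φ′⊆ x) (φ′⊆ y) (edge x y xy)

-- Minimal assignments are flat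

module _ {n} (G : Graph n) where

  obtainable-assignment : ∀ {a L L′} → Obtainable G L L′ → IsAssignment a L → IsAssignment a L′
  obtainable-assignment ε = id
  obtainable-assignment (move α r β _ _ _ β∉C ◅ moves) =
    obtainable-assignment moves ∘ FlatteningMove.assignment G _ α r β β∉C

  obtainable-pullback : ∀ {b L L′} → Obtainable G L L′ → HasFoldColoring G b L′ → HasFoldColoring G b L
  obtainable-pullback ε = id
  obtainable-pullback (move α r β _ _ _ β∉C ◅ moves) =
    FlatteningMove.pullback G _ α r β β∉C ∘ obtainable-pullback moves

  measure : Assignment n → ℕ × ℕ
  measure L = potSize L , componentSum G L

  _⊏_ : Assignment n → Assignment n → Set
  _⊏_ = ×-Lex _≡_ _<_ _<_ on measure

  ⊏-wellFounded : WellFounded _⊏_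
  ⊏-wellFounded = On.wellFounded measure (×-wellFounded <-wellFounded <-wellFounded)

  minimal⇒flat : ∀ {L} → (∀ L′ → Obtainable G L L′ → ¬ L′ ⊏ L) → Flat G L
  minimal⇒flat minimal =
    (λ L′ o → ≮⇒≥ (minimal L′ o ∘ inj₁)) ,
    (λ L′ o same → ≮⇒≥ (minimal L′ o ∘ inj₂ ∘ (same ,_)))

  module _ {a b} (colour-flat : ∀ L → IsAssignment a L → Flat G L → HasFoldColoring G b L) where

    ¬¬colourable : ∀ L → IsAssignment a L → ¬ ¬ HasFoldColoring G b L
    ¬¬colourable = WF.All.wfRec ⊏-wellFounded _ _ λ L ih isA uncolourable →
      uncolourable (colour-flat L isA (minimal⇒flat λ L′ o L′⊏L →
        ih L′⊏L (obtainable-assignment o isA) (uncolourable ∘ obtainable-pullback o)))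

corollary24 : ∀ {n} (G : Graph n) (a b : ℕ) → 1 ≤ a → 1 ≤ b →
    ((L : Assignment n) → IsAssignment a L → Flat G L → HasFoldColoring G b L) →
    Choosable G a b
corollary24 G a b _ _ colour-flat L isA =
  decidable-stable (hasFoldColoring? G b L (proj₁ ∘ isA)) (¬¬colourable G colour-flat L isA)
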